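{- For every nested sequent $\Gamma \vdash \Delta$: if $\Gamma \vdash \Delta$ is derivable in the nested sequent calculus $\mathbf{N}\text{ - }\mathbf{LBiI}$, then the standard sequent $\Gamma^{\flat} \vdash \Delta^{\sharp}$ is derivable in the standard sequent calculus $\mathbf{LBiI}$.
   Context: Formulas of bi-intuitionistic propositional logic: $A,B ::= p \mid \top \mid \bot \mid A\wedge B \mid A \vee B \mid A \supset B \mid A \mathbin{ -\!\!<} B$, with $p$ ranging over propositional variables and $A \mathbin{ -\!\!<} B$ the exclusion of $B$ from $A$. The calculus $\mathbf{LBiI}$: sequents are $\Gamma \vdash \Delta$ with $\Gamma,\Delta$ finite multisets of formulas (comma = multiset union). Rules (premises $\Rightarrow$ conclusion): hyp: $\Gamma, A \vdash A, \Delta$ (no premises); cut: $\Gamma \vdash A,\Delta$ and $\Gamma, A\vdash \Delta$ $\Rightarrow$ $\Gamma\vdash\Delta$; weakL: $\Gamma\vdash\Delta \Rightarrow \Gamma,A\vdash\Delta$; weakR: $\Gamma\vdash\Delta\Rightarrow\Gamma\vdash A,\Delta$; contrL: $\Gamma,A,A\vdash\Delta\Rightarrow\Gamma,A\vdash\Delta$; contrR: $\Gamma\vdash A,A,\Delta\Rightarrow\Gamma\vdash A,\Delta$; $\top$L: $\Gamma\vdash\Delta\Rightarrow\Gamma,\top\vdash\Delta$; $\top$R: $\Gamma\vdash\top,\Delta$; $\bot$L: $\Gamma,\bot\vdash\Delta$; $\bot$R: $\Gamma\vdash\Delta\Rightarrow\Gamma\vdash\bot,\Delta$; $\wedge$L: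 $\Gamma,A,B\vdash\Delta\Rightarrow\Gamma,A\wedge B\vdash\Delta$; $\wedge$R: $\Gamma\vdash A,\Delta$ and $\Gamma\vdash B,\Delta\Rightarrow\Gamma\vdash A\wedge B,\Delta$; $\vee$L: $\Gamma,A\vdash\Delta$ and $\Gamma,B\vdash\Delta\Rightarrow\Gamma,A\vee B\vdash\Delta$; $\vee$R: $\Gamma\vdash A,B,\Delta\Rightarrow\Gamma\vdash A\vee B,\Delta$; $\supset$L: $\Gamma,A\supset B\vdash A,\Delta$ and $\Gamma,B\vdash\Delta\Rightarrow\Gamma,A\supset B\vdash\Delta$; $\supset$R: $\Gamma,A\vdash B\Rightarrow\Gamma\vdash A\supset B,\Delta$; $\mathbin{ -\!\!<}$L: $A\vdash B,\Delta\Rightarrow\Gamma,A\mathbin{ -\!\!<}B\vdash\Delta$; $\mathbin{ -\!\!<}$R: $\Gamma\vdash A,\Delta$ and $\Gamma,B\vdash A\mathbin{ -\!\!<}B,\Delta\Rightarrow\Gamma\vdash A\mathbin{ -\!\!<}B,\Delta$. The calculus $\mathbf{N}\text{ - }\mathbf{LBiI}$: nested sequents $S ::= \Gamma\vdash\Delta$ and nested contexts $\Gamma,\Delta ::= \emptyset \mid A,\Gamma \mid S,\Gamma$, contexts taken up to permutation (finite multisets of formulas and nested sequents). Its rules are all the rules of $\mathbf{LBiI}$ above (with $\Gamma,\Delta$ now ranging over nested contexts and $A,B$ over formulas), plus: nestL: $\Gamma_0\vdash\Delta_0,\Delta\Rightarrow\Gamma,(\Gamma_0\vdash\Delta_0)\vdash\Delta$;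 nestR: $\Gamma,\Gamma_0\vdash\Delta_0\Rightarrow\Gamma\vdash(\Gamma_0\vdash\Delta_0),\Delta$; unnestL: $\Gamma,(\Gamma_0\vdash\Delta_0)\vdash\Delta\Rightarrow\Gamma,\Gamma_0\vdash\Delta_0,\Delta$; unnestR: $\Gamma\vdash(\Gamma_0\vdash\Delta_0),\Delta\Rightarrow\Gamma,\Gamma_0\vdash\Delta_0,\Delta$. Flattening: define formulas $\Gamma^{\wedge}$, $\Delta^{\vee}$ from nested contexts simultaneously: $\emptyset^{\wedge}=\top$, $(A,\Gamma)^{\wedge}=A\wedge\Gamma^{\wedge}$, $((\Gamma_0\vdash\Delta_0),\Gamma)^{\wedge}=(\Gamma_0^{\wedge}\mathbin{ -\!\!<}\Delta_0^{\vee})\wedge\Gamma^{\wedge}$; $\emptyset^{\vee}=\bot$, $(A,\Gamma)^{\vee}=A\vee\Gamma^{\vee}$, $((\Gamma_0\vdash\Delta_0),\Gamma)^{\vee}=(\Gamma_0^{\wedge}\supset\Delta_0^{\vee})\vee\Gamma^{\vee}$. Then standard contexts $\Gamma^{\flat}$, $\Delta^{\sharp}$: $\emptyset^{\flat}=\emptyset$, $(A,\Gamma)^{\flat}=A,\Gamma^{\flat}$, $((\Gamma_0\vdash\Delta_0),\Gamma)^{\flat}=(\Gamma_0^{\wedge}\mathbin{ -\!\!<}\Delta_0^{\vee}),\Gamma^{\flat}$; $\emptyset^{\sharp}=\emptyset$, $(A,\Gamma)^{\sharp}=A,\Gamma^{\sharp}$, $((\Gamma_0\vdash\Delta_0),\Gamma)^{\sharp}=(\Gamma_0^{\wedge}\supset\Delta_0^{\vee}),\Gamma^{\sharp}$.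 -}

module Defs where

open import Data.Nat using (ℕ)
open import Data.List using (List; []; _∷_; _++_)
open import Data.List.Relation.Binary.Permutation.Propositional using (_↭_)

infixr 6 _∧_
infixr 5 _∨_
infixr 4 _⊃_ _-<_

data Formula : Set where
  var  : ℕ → Formula
  ⊤′   : Formula
  ⊥′   : Formula
  _∧_  : Formula → Formula → Formula
  _∨_  : Formula → Formula → Formula
  _⊃_  : Formula → Formula → Formula
  _-<_ : Formula → Formula → Formula   -- exclusion of B from A

-- Standard contexts: finite multisets, represented by lists up to permutation
-- (the exchange rules exL / exR below make derivability invariant under _↭_).
Ctx : Set
Ctx = List Formula


data LBiI : Ctx → Ctx → Set where
  exL    : ∀ {Γ Γ′ Δ} → Γ ↭ Γ′ → LBiI Γ Δ → LBiI Γ′ Δ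
  exR    : ∀ {Γ Δ Δ′} → Δ ↭ Δ′ → LBiI Γ Δ → LBiI Γ Δ′
  hyp    : ∀ {Γ Δ A} → LBiI (A ∷ Γ) (A ∷ Δ)
  cut    : ∀ {Γ Δ} A → LBiI Γ (A ∷ Δ) → LBiI (A ∷ Γ) Δ → LBiI Γ Δ
  weakL  : ∀ {Γ Δ A} → LBiI Γ Δ → LBiI (A ∷ Γ) Δ
  weakR  : ∀ {Γ Δ A} → LBiI Γ Δ → LBiI Γ (A ∷ Δ)
  contrL : ∀ {Γ Δ A} → LBiI (A ∷ A ∷ Γ) Δ → LBiI (A ∷ Γ) Δ
  contrR : ∀ {Γ Δ A} → LBiI Γ (A ∷ A ∷ Δ) → LBiI Γ (A ∷ Δ)
  ⊤L     : ∀ {Γ Δ} → LBiI Γ Δ → LBiI (⊤′ ∷ Γ) Δ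
  ⊤R     : ∀ {Γ Δ} → LBiI Γ (⊤′ ∷ Δ)
  ⊥L     : ∀ {Γ Δ} → LBiI (⊥′ ∷ Γ) Δ
  ⊥R     : ∀ {Γ Δ} → LBiI Γ Δ → LBiI Γ (⊥′ ∷ Δ)
  ∧L     : ∀ {Γ Δ A B} → LBiI (A ∷ B ∷ Γ) Δ → LBiI ((A ∧ B) ∷ Γ) Δ
  ∧R     : ∀ {Γ Δ A B} → LBiI Γ (A ∷ Δ) → LBiI Γ (B ∷ Δ) → LBiI Γ ((A ∧ B) ∷ Δ)
  ∨L     : ∀ {Γ Δ A B} → LBiI (A ∷ Γ) Δ → LBiI (B ∷ Γ) Δ → LBiI ((A ∨ B) ∷ Γ) Δ
  ∨R     : ∀ {Γ Δ A B} → LBiI Γ (A ∷ B ∷ Δ) → LBiI Γ ((A ∨ B) ∷ Δ)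
  ⊃L     : ∀ {Γ Δ A B} → LBiI ((A ⊃ B) ∷ Γ) (A ∷ Δ) → LBiI (B ∷ Γ) Δ → LBiI ((A ⊃ B) ∷ Γ) Δ
  ⊃R     : ∀ {Γ Δ A B} → LBiI (A ∷ Γ) (B ∷ []) → LBiI Γ ((A ⊃ B) ∷ Δ)
  -<L    : ∀ {Γ Δ A B} → LBiI (A ∷ []) (B ∷ Δ) → LBiI ((A -< B) ∷ Γ) Δ
  -<R    : ∀ {Γ Δ A B} → LBiI Γ (A ∷ Δ) → LBiI (B ∷ Γ) ((A -< B) ∷ Δ) → LBiI Γ ((A -< B) ∷ Δ)

data Item : Set
data Seq : Set

NCtx : Set
NCtx = List Item

data Seq where
  _⊢_ : List Item → List Item → Seq

data Item where
  fm  : Formula → Item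
  seq : Seq → Item

data NLBiI : NCtx → NCtx → Set where
  exL    : ∀ {Γ Γ′ Δ} → Γ ↭ Γ′ → NLBiI Γ Δ → NLBiI Γ′ Δ
  exR    : ∀ {Γ Δ Δ′} → Δ ↭ Δ′ → NLBiI Γ Δ → NLBiI Γ Δ′
  hyp    : ∀ {Γ Δ A} → NLBiI (fm A ∷ Γ) (fm A ∷ Δ)
  cut    : ∀ {Γ Δ} A → NLBiI Γ (fm A ∷ Δ) → NLBiI (fm A ∷ Γ) Δ → NLBiI Γ Δ
  weakL  : ∀ {Γ Δ A} → NLBiI Γ Δ → NLBiI (fm A ∷ Γ) Δ
  weakR  : ∀ {Γ Δ A} → NLBiI Γ Δ → NLBiI Γ (fm A ∷ Δ)
  contrL : ∀ {Γ Δ A} → NLBiI (fm A ∷ fm A ∷ Γ) Δ → NLBiI (fm A ∷ Γ) Δ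
  contrR : ∀ {Γ Δ A} → NLBiI Γ (fm A ∷ fm A ∷ Δ) → NLBiI Γ (fm A ∷ Δ)
  ⊤L     : ∀ {Γ Δ} → NLBiI Γ Δ → NLBiI (fm ⊤′ ∷ Γ) Δ
  ⊤R     : ∀ {Γ Δ} → NLBiI Γ (fm ⊤′ ∷ Δ)
  ⊥L     : ∀ {Γ Δ} → NLBiI (fm ⊥′ ∷ Γ) Δ
  ⊥R     : ∀ {Γ Δ} → NLBiI Γ Δ → NLBiI Γ (fm ⊥′ ∷ Δ)
  ∧L     : ∀ {Γ Δ A B} → NLBiI (fm A ∷ fm B ∷ Γ) Δ → NLBiI (fm (A ∧ B) ∷ Γ) Δ
  ∧R     : ∀ {Γ Δ A B} → NLBiI Γ (fm A ∷ Δ) → NLBiI Γ (fm B ∷ Δ) → NLBiI Γ (fm (A ∧ B) ∷ Δ)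
  ∨L     : ∀ {Γ Δ A B} → NLBiI (fm A ∷ Γ) Δ → NLBiI (fm B ∷ Γ) Δ → NLBiI (fm (A ∨ B) ∷ Γ) Δ
  ∨R     : ∀ {Γ Δ A B} → NLBiI Γ (fm A ∷ fm B ∷ Δ) → NLBiI Γ (fm (A ∨ B) ∷ Δ)
  ⊃L     : ∀ {Γ Δ A B} → NLBiI (fm (A ⊃ B) ∷ Γ) (fm A ∷ Δ) → NLBiI (fm B ∷ Γ) Δ
         → NLBiI (fm (A ⊃ B) ∷ Γ) Δ
  ⊃R     : ∀ {Γ Δ A B} → NLBiI (fm A ∷ Γ) (fm B ∷ []) → NLBiI Γ (fm (A ⊃ B) ∷ Δ)
  -<L    : ∀ {Γ Δ A B} → NLBiI (fm A ∷ []) (fm B ∷ Δ) → NLBiI (fm (A -< B) ∷ Γ) Δ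
  -<R    : ∀ {Γ Δ A B} → NLBiI Γ (fm A ∷ Δ) → NLBiI (fm B ∷ Γ) (fm (A -< B) ∷ Δ)
         → NLBiI Γ (fm (A -< B) ∷ Δ)
  nestL   : ∀ {Γ Δ Γ₀ Δ₀} → NLBiI Γ₀ (Δ₀ ++ Δ) → NLBiI (seq (Γ₀ ⊢ Δ₀) ∷ Γ) Δ
  nestR   : ∀ {Γ Δ Γ₀ Δ₀} → NLBiI (Γ ++ Γ₀) Δ₀ → NLBiI Γ (seq (Γ₀ ⊢ Δ₀) ∷ Δ)
  unnestL : ∀ {Γ Δ Γ₀ Δ₀} → NLBiI (seq (Γ₀ ⊢ Δ₀) ∷ Γ) Δ → NLBiI (Γ ++ Γ₀) (Δ₀ ++ Δ)
  unnestR : ∀ {Γ Δ Γ₀ Δ₀} → NLBiI Γ (seq (Γ₀ ⊢ Δ₀) ∷ Δ) → NLBiI (Γ ++ Γ₀) (Δ₀ ++ Δ)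

_^∧ : NCtx → Formula
_^∨ : NCtx → Formula
[] ^∧ = ⊤′
(fm A ∷ Γ) ^∧ = A ∧ (Γ ^∧)
(seq (Γ₀ ⊢ Δ₀) ∷ Γ) ^∧ = ((Γ₀ ^∧) -< (Δ₀ ^∨)) ∧ (Γ ^∧)
[] ^∨ = ⊥′
(fm A ∷ Γ) ^∨ = A ∨ (Γ ^∨)
(seq (Γ₀ ⊢ Δ₀) ∷ Γ) ^∨ = ((Γ₀ ^∧) ⊃ (Δ₀ ^∨)) ∨ (Γ ^∨)

_♭ : NCtx → Ctx
[] ♭ = []
(fm A ∷ Γ) ♭ = A ∷ Γ ♭
(seq (Γ₀ ⊢ Δ₀) ∷ Γ) ♭ = ((Γ₀ ^∧) -< (Δ₀ ^∨)) ∷ Γ ♭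

_♯ : NCtx → Ctx
[] ♯ = []
(fm A ∷ Γ) ♯ = A ∷ Γ ♯
(seq (Γ₀ ⊢ Δ₀) ∷ Γ) ♯ = ((Γ₀ ^∧) ⊃ (Δ₀ ^∨)) ∷ Γ ♯

-- A nested sequent Γ₀ ⊢ Δ₀ behaves as the formula Γ₀^∧ -< Δ₀^∨ on the left and
-- Γ₀^∧ ⊃ Δ₀^∨ on the right, so every N-LBiI rule other than the four nesting rules
-- is literally an LBiI rule on the flattened sequent. nestL and nestR become -<L
-- and ⊃R once the conjunction Γ₀^∧ and the disjunction Δ₀^∨ are unfolded back into
-- their components; unnestL and unnestR become cuts on that formula, whose other
-- premise just reassembles Γ₀^∧ and Δ₀^∨ from their components.
module Submission where

open import Defs
open import Data.List using ([]; _∷_; _++_; map; foldr)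
open import Data.List.Properties using (map-++; ++-identityʳ)
open import Data.List.Relation.Binary.Permutation.Propositional
  using (_↭_; swap; ↭-refl; ↭-sym; ↭-reflexive)
open import Data.List.Relation.Binary.Permutation.Propositional.Properties
  using (map⁺; ++-comm; shift)
open import Relation.Binary.PropositionalEquality using (_≡_; refl; cong; sym)

⋀ : Ctx → Formula
⋀ = foldr _∧_ ⊤′

⋁ : Ctx → Formula
⋁ = foldr _∨_ ⊥′

weakL-++ : ∀ {Γ Δ} Σ → LBiI Γ Δ → LBiI (Γ ++ Σ) Δ
weakL-++ {Γ} {Δ} Σ d = exL (++-comm Σ Γ) (weakL* Σ)
  where
  weakL* : ∀ Σ → LBiI (Σ ++ Γ) Δ
  weakL* []      = d
  weakL* (_ ∷ Σ) = weakL (weakL* Σ)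

weakR-++ : ∀ {Γ Δ} Σ → LBiI Γ Δ → LBiI Γ (Σ ++ Δ)
weakR-++ []      d = d
weakR-++ (_ ∷ Σ) d = weakR (weakR-++ Σ d)

⋀L : ∀ Σ {Γ Δ} → LBiI (Σ ++ Γ) Δ → LBiI (⋀ Σ ∷ Γ) Δ
⋀L []      d = ⊤L d
⋀L (A ∷ Σ) {Γ} d = ∧L (exL (swap (⋀ Σ) A ↭-refl) (⋀L Σ (exL (↭-sym (shift A Σ Γ)) d)))

⋁R : ∀ Σ {Γ Δ} → LBiI Γ (Σ ++ Δ) → LBiI Γ (⋁ Σ ∷ Δ)
⋁R []      d = ⊥R d
⋁R (A ∷ Σ) {Δ = Δ} d = ∨R (exR (swap (⋁ Σ) A ↭-refl) (⋁R Σ (exR (↭-sym (shift A Σ Δ)) d)))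

⋀R : ∀ Σ {Γ Δ} → LBiI (Σ ++ Γ) (⋀ Σ ∷ Δ)
⋀R []      = ⊤R
⋀R (A ∷ Σ) = ∧R hyp (weakL (⋀R Σ))

⋁L : ∀ Σ {Γ Δ} → LBiI (⋁ Σ ∷ Γ) (Σ ++ Δ)
⋁L []      = ⊥L
⋁L (A ∷ Σ) = ∨L hyp (weakR (⋁L Σ))

-<L-⋀⋁ : ∀ Γ₀ Δ₀ {Γ Δ} → LBiI Γ₀ (Δ₀ ++ Δ) → LBiI ((⋀ Γ₀ -< ⋁ Δ₀) ∷ Γ) Δ
-<L-⋀⋁ Γ₀ Δ₀ d = -<L (⋀L Γ₀ (exL (↭-reflexive (sym (++-identityʳ Γ₀))) (⋁R Δ₀ d)))

⊃R-⋀⋁ : ∀ Γ₀ Δ₀ {Γ Δ} → LBiI (Γ ++ Γ₀) Δ₀ → LBiI Γ ((⋀ Γ₀ ⊃ ⋁ Δ₀) ∷ Δ)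
⊃R-⋀⋁ Γ₀ Δ₀ {Γ} d =
  ⊃R (⋀L Γ₀ (⋁R Δ₀ (exR (↭-reflexive (sym (++-identityʳ Δ₀))) (exL (++-comm Γ Γ₀) d))))

-<-unfold : ∀ Γ₀ Δ₀ {Γ Δ} → LBiI ((⋀ Γ₀ -< ⋁ Δ₀) ∷ Γ) Δ → LBiI (Γ ++ Γ₀) (Δ₀ ++ Δ)
-<-unfold Γ₀ Δ₀ {Γ} d =
  cut (⋀ Γ₀ -< ⋁ Δ₀)
      (-<R (exL (++-comm Γ₀ Γ) (⋀R Γ₀)) (weakR (⋁L Δ₀)))
      (weakL-++ Γ₀ (weakR-++ Δ₀ d))

⊃-unfold : ∀ Γ₀ Δ₀ {Γ Δ} → LBiI Γ ((⋀ Γ₀ ⊃ ⋁ Δ₀) ∷ Δ) → LBiI (Γ ++ Γ₀) (Δ₀ ++ Δ)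
⊃-unfold Γ₀ Δ₀ {Γ} {Δ} d =
  cut (⋀ Γ₀ ⊃ ⋁ Δ₀)
      (exR (shift _ Δ₀ Δ) (weakR-++ Δ₀ (weakL-++ Γ₀ d)))
      (⊃L (weakL (exL (++-comm Γ₀ Γ) (⋀R Γ₀))) (⋁L Δ₀))

itemˡ : Item → Formula
itemˡ (fm A)            = A
itemˡ (seq (Γ₀ ⊢ Δ₀)) = Γ₀ ^∧ -< Δ₀ ^∨

itemʳ : Item → Formula
itemʳ (fm A)            = A
itemʳ (seq (Γ₀ ⊢ Δ₀)) = Γ₀ ^∧ ⊃ Δ₀ ^∨

♭≡map : ∀ Γ → Γ ♭ ≡ map itemˡ Γ
♭≡map []                  = refl
♭≡map (fm _ ∷ Γ)          = cong (_ ∷_) (♭≡map Γ)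
♭≡map (seq (_ ⊢ _) ∷ Γ) = cong (_ ∷_) (♭≡map Γ)

♯≡map : ∀ Δ → Δ ♯ ≡ map itemʳ Δ
♯≡map []                  = refl
♯≡map (fm _ ∷ Δ)          = cong (_ ∷_) (♯≡map Δ)
♯≡map (seq (_ ⊢ _) ∷ Δ) = cong (_ ∷_) (♯≡map Δ)

♭-↭ : ∀ {Γ Γ′} → Γ ↭ Γ′ → Γ ♭ ↭ Γ′ ♭
♭-↭ {Γ} {Γ′} p rewrite ♭≡map Γ | ♭≡map Γ′ = map⁺ itemˡ p

♯-↭ : ∀ {Δ Δ′} → Δ ↭ Δ′ → Δ ♯ ↭ Δ′ ♯
♯-↭ {Δ} {Δ′} p rewrite ♯≡map Δ | ♯≡map Δ′ = map⁺ itemʳ p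

♭-++ : ∀ Γ Γ′ → (Γ ++ Γ′) ♭ ≡ Γ ♭ ++ Γ′ ♭
♭-++ Γ Γ′ rewrite ♭≡map (Γ ++ Γ′) | ♭≡map Γ | ♭≡map Γ′ = map-++ itemˡ Γ Γ′

♯-++ : ∀ Δ Δ′ → (Δ ++ Δ′) ♯ ≡ Δ ♯ ++ Δ′ ♯
♯-++ Δ Δ′ rewrite ♯≡map (Δ ++ Δ′) | ♯≡map Δ | ♯≡map Δ′ = map-++ itemʳ Δ Δ′

^∧≡⋀♭ : ∀ Γ → Γ ^∧ ≡ ⋀ (Γ ♭)
^∧≡⋀♭ []                  = refl
^∧≡⋀♭ (fm _ ∷ Γ)          = cong (_ ∧_) (^∧≡⋀♭ Γ)
^∧≡⋀♭ (seq (_ ⊢ _) ∷ Γ) = cong (_ ∧_) (^∧≡⋀♭ Γ)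

^∨≡⋁♯ : ∀ Δ → Δ ^∨ ≡ ⋁ (Δ ♯)
^∨≡⋁♯ []                  = refl
^∨≡⋁♯ (fm _ ∷ Δ)          = cong (_ ∨_) (^∨≡⋁♯ Δ)
^∨≡⋁♯ (seq (_ ⊢ _) ∷ Δ) = cong (_ ∨_) (^∨≡⋁♯ Δ)

nestL-sound : ∀ Γ₀ Δ₀ {Γ Δ} → LBiI (Γ₀ ♭) ((Δ₀ ++ Δ) ♯) → LBiI ((seq (Γ₀ ⊢ Δ₀) ∷ Γ) ♭) (Δ ♯)
nestL-sound Γ₀ Δ₀ {Δ = Δ} d rewrite ^∧≡⋀♭ Γ₀ | ^∨≡⋁♯ Δ₀ | ♯-++ Δ₀ Δ =
  -<L-⋀⋁ (Γ₀ ♭) (Δ₀ ♯) d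

nestR-sound : ∀ Γ₀ Δ₀ {Γ Δ} → LBiI ((Γ ++ Γ₀) ♭) (Δ₀ ♯) → LBiI (Γ ♭) ((seq (Γ₀ ⊢ Δ₀) ∷ Δ) ♯)
nestR-sound Γ₀ Δ₀ {Γ} d rewrite ^∧≡⋀♭ Γ₀ | ^∨≡⋁♯ Δ₀ | ♭-++ Γ Γ₀ =
  ⊃R-⋀⋁ (Γ₀ ♭) (Δ₀ ♯) d

unnestL-sound : ∀ Γ₀ Δ₀ {Γ Δ} → LBiI ((seq (Γ₀ ⊢ Δ₀) ∷ Γ) ♭) (Δ ♯)
              → LBiI ((Γ ++ Γ₀) ♭) ((Δ₀ ++ Δ) ♯)
unnestL-sound Γ₀ Δ₀ {Γ} {Δ} d
  rewrite ^∧≡⋀♭ Γ₀ | ^∨≡⋁♯ Δ₀ | ♭-++ Γ Γ₀ | ♯-++ Δ₀ Δ =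
  -<-unfold (Γ₀ ♭) (Δ₀ ♯) d

unnestR-sound : ∀ Γ₀ Δ₀ {Γ Δ} → LBiI (Γ ♭) ((seq (Γ₀ ⊢ Δ₀) ∷ Δ) ♯)
              → LBiI ((Γ ++ Γ₀) ♭) ((Δ₀ ++ Δ) ♯)
unnestR-sound Γ₀ Δ₀ {Γ} {Δ} d
  rewrite ^∧≡⋀♭ Γ₀ | ^∨≡⋁♯ Δ₀ | ♭-++ Γ Γ₀ | ♯-++ Δ₀ Δ =
  ⊃-unfold (Γ₀ ♭) (Δ₀ ♯) d

mainTheorem1 : (Γ Δ : NCtx) → NLBiI Γ Δ → LBiI (Γ ♭) (Δ ♯)
mainTheorem1 _ _ (exL p d)   = exL (♭-↭ p) (mainTheorem1 _ _ d)
mainTheorem1 _ _ (exR p d)   = exR (♯-↭ p) (mainTheorem1 _ _ d)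
mainTheorem1 _ _ hyp         = hyp
mainTheorem1 _ _ (cut A d e) = cut A (mainTheorem1 _ _ d) (mainTheorem1 _ _ e)
mainTheorem1 _ _ (weakL d)   = weakL (mainTheorem1 _ _ d)
mainTheorem1 _ _ (weakR d)   = weakR (mainTheorem1 _ _ d)
mainTheorem1 _ _ (contrL d)  = contrL (mainTheorem1 _ _ d)
mainTheorem1 _ _ (contrR d)  = contrR (mainTheorem1 _ _ d)
mainTheorem1 _ _ (⊤L d)      = ⊤L (mainTheorem1 _ _ d)
mainTheorem1 _ _ ⊤R          = ⊤R
mainTheorem1 _ _ ⊥L          = ⊥L
mainTheorem1 _ _ (⊥R d)      = ⊥R (mainTheorem1 _ _ d)
mainTheorem1 _ _ (∧L d)      = ∧L (mainTheorem1 _ _ d)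
mainTheorem1 _ _ (∧R d e)    = ∧R (mainTheorem1 _ _ d) (mainTheorem1 _ _ e)
mainTheorem1 _ _ (∨L d e)    = ∨L (mainTheorem1 _ _ d) (mainTheorem1 _ _ e)
mainTheorem1 _ _ (∨R d)      = ∨R (mainTheorem1 _ _ d)
mainTheorem1 _ _ (⊃L d e)    = ⊃L (mainTheorem1 _ _ d) (mainTheorem1 _ _ e)
mainTheorem1 _ _ (⊃R d)      = ⊃R (mainTheorem1 _ _ d)
mainTheorem1 _ _ (-<L d)     = -<L (mainTheorem1 _ _ d)
mainTheorem1 _ _ (-<R d e)   = -<R (mainTheorem1 _ _ d) (mainTheorem1 _ _ e)
mainTheorem1 _ _ (nestL {Γ₀ = Γ₀} {Δ₀} d)   = nestL-sound Γ₀ Δ₀ (mainTheorem1 _ _ d)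
mainTheorem1 _ _ (nestR {Γ₀ = Γ₀} {Δ₀} d)   = nestR-sound Γ₀ Δ₀ (mainTheorem1 _ _ d)
mainTheorem1 _ _ (unnestL {Γ₀ = Γ₀} {Δ₀} d) = unnestL-sound Γ₀ Δ₀ (mainTheorem1 _ _ d)
mainTheorem1 _ _ (unnestR {Γ₀ = Γ₀} {Δ₀} d) = unnestR-sound Γ₀ Δ₀ (mainTheorem1 _ _ d)
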